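{- Let $\pi\in K_n$ and let $C(\pi)=\{\sigma\in\bigcup_{l<n}K_l : \sigma\prec\pi \text{ and there is no }\delta\in\bigcup_{l<n}K_l\text{ with }\sigma\prec\delta\prec\pi\}$. If there is exactly one $\sigma\in C(\pi)$ such that $[3142]\prec\sigma$ and $[2413]\prec\sigma$, then $\mu(\pi)=0$.
   Context: $K_n$ is the set of permutations $\sigma\in S_n$ (one-line notation $[\sigma_1,\dots,\sigma_n]$) with $|\sigma_i-\sigma_{i-1}|\neq1$ for all $2\le i\le n$, and $\mathcal{K}=\bigcup_{n\ge1}K_n$, partially ordered by containment: $\pi\preceq\sigma$ if some subsequence of $\sigma$ is order-isomorphic to $\pi$; $\pi\prec\sigma$ means $\pi\preceq\sigma$, $\pi\ne\sigma$. The Möbius function on $\mathcal{K}$ is $\mu(\tau,\sigma)=0$ if $\tau\not\preceq\sigma$, $\mu(\sigma,\sigma)=1$, and otherwise $\mu(\tau,\sigma)=-\sum_{\pi\in\mathcal{K},\,\tau\preceq\pi\prec\sigma}\mu(\tau,\pi)$. We write $\mu(\pi)=\mu([1],\pi)$. -}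

module Defs where

open import Data.Bool using (Bool; true; false; _∧_; _∨_; not; if_then_else_)
open import Data.Nat using (ℕ; zero; suc; _<_; _≤_; _<ᵇ_; _≡ᵇ_)
open import Data.List using (List; []; _∷_; map; _++_; concatMap; filterᵇ; length; zip; applyUpTo; foldr)
open import Data.Bool.ListAction using (all; any)
open import Data.List.Membership.Propositional using (_∈_)
open import Data.Integer using (ℤ; -_) renaming (_+_ to _+ℤ_)
import Data.Integer as ℤ
open import Data.Product using (Σ; _×_; ∃; _,_)
open import Relation.Binary.PropositionalEquality using (_≡_; _≢_)
open import Relation.Nullary using (¬_)

-- Permutations are lists of naturals in one-line notation [σ₁,…,σₙ]
-- with values 1..n.

insertEverywhere : ℕ → List ℕ → List (List ℕ)
insertEverywhere x [] = (x ∷ []) ∷ []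
insertEverywhere x (y ∷ ys) = (x ∷ y ∷ ys) ∷ map (y ∷_) (insertEverywhere x ys)

S : ℕ → List (List ℕ)
S zero = [] ∷ []
S (suc n) = concatMap (insertEverywhere (suc n)) (S n)

notAdjacentValues : ℕ → ℕ → Bool
notAdjacentValues a b = not ((suc a ≡ᵇ b) ∨ (suc b ≡ᵇ a))

noAdj : List ℕ → Bool
noAdj [] = true
noAdj (x ∷ []) = true
noAdj (x ∷ y ∷ ys) = notAdjacentValues x y ∧ noAdj (y ∷ ys)

K : ℕ → List (List ℕ)
K n = filterᵇ noAdj (S n)

-- ⋃_{1 ≤ l ≤ m} K_l  (the elements of 𝒦 of size at most m)
Kupto : ℕ → List (List ℕ)
Kupto m = concatMap (λ i → K (suc i)) (applyUpTo (λ i → i) m)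

sameOrder : ℕ → ℕ → ℕ → ℕ → Bool
sameOrder x x' y y' = ((x <ᵇ x') ≡ᵇBool (y <ᵇ y')) ∧ ((x' <ᵇ x) ≡ᵇBool (y' <ᵇ y))
  where
  _≡ᵇBool_ : Bool → Bool → Bool
  true ≡ᵇBool b = b
  false ≡ᵇBool b = not b

orderIso : List ℕ → List ℕ → Bool
orderIso [] [] = true
orderIso [] (_ ∷ _) = false
orderIso (_ ∷ _) [] = false
orderIso (x ∷ xs) (y ∷ ys) =
  orderIso xs ys ∧ (length xs ≡ᵇ length ys) ∧
  all (λ p → sameOrder x (Data.Product.proj₁ p) y (Data.Product.proj₂ p)) (zip xs ys)

subseqs : List ℕ → List (List ℕ)
subseqs [] = [] ∷ []
subseqs (x ∷ xs) = map (x ∷_) (subseqs xs) ++ subseqs xs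

contains : List ℕ → List ℕ → Bool
contains π σ = any (orderIso π) (subseqs σ)

eqList : List ℕ → List ℕ → Bool
eqList [] [] = true
eqList [] (_ ∷ _) = false
eqList (_ ∷ _) [] = false
eqList (x ∷ xs) (y ∷ ys) = (x ≡ᵇ y) ∧ eqList xs ys

strictlyContained : List ℕ → List ℕ → Bool
strictlyContained π σ = contains π σ ∧ not (eqList π σ)

sumℤ : List ℤ → ℤ
sumℤ = foldr _+ℤ_ (ℤ.+ 0)

-- Möbius function μ(τ,σ) on 𝒦, computed with fuel (fuel = |σ|+1 suffices,
-- since every π with τ ⪯ π ≺ σ has |π| < |σ|).  The sum ranges over
-- π ∈ 𝒦 with τ ⪯ π ≺ σ; all such π have size ≤ |σ|, so they are in Kupto |σ|.
mobiusF : ℕ → List ℕ → List ℕ → ℤ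
mobiusF zero τ σ = ℤ.+ 0
mobiusF (suc f) τ σ =
  if contains τ σ
  then (if eqList τ σ
        then ℤ.+ 1
        else - sumℤ (map (mobiusF f τ)
                         (filterᵇ (λ π → contains τ π ∧ strictlyContained π σ)
                                  (Kupto (length σ)))))
  else ℤ.+ 0

μ₂ : List ℕ → List ℕ → ℤ
μ₂ τ σ = mobiusF (suc (length σ)) τ σ

μ : List ℕ → ℤ
μ π = μ₂ (1 ∷ []) π

_≺_ : List ℕ → List ℕ → Set
σ ≺ π = (contains σ π ≡ true) × (σ ≢ π)

-- σ ∈ ⋃_{l<n} K_l  (l ≥ 1, as in 𝒦)
InKbelow : ℕ → List ℕ → Set
InKbelow n σ = Σ ℕ (λ l → (1 ≤ l) × (l < n) × (σ ∈ K l))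

InC : ℕ → List ℕ → List ℕ → Set
InC n π σ = InKbelow n σ × (σ ≺ π) ×
            ¬ (Σ (List ℕ) (λ δ → InKbelow n δ × (σ ≺ δ) × (δ ≺ π)))

Good : List ℕ → Set
Good σ = ((3 ∷ 1 ∷ 4 ∷ 2 ∷ []) ≺ σ) × ((2 ∷ 4 ∷ 1 ∷ 3 ∷ []) ≺ σ)

-- Every permutation in 𝒦 of length at least 2 contains 3142 or 2413: otherwise it would be
-- separable, and a separable permutation has two adjacent entries with consecutive values.
-- Consequently μ vanishes on every δ ≠ 3142 in 𝒦 that contains 3142 but not 2413 (and
-- symmetrically): the nonzero terms of its defining sum are exactly those over the closed interval
-- [1, 3142], and the sum of μ over a closed interval [1, σ] with σ ≠ [1] is 0. So μ is supported
-- on [1], 3142, 2413 and the permutations containing both patterns. Below π, a permutation of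
-- the last kind lies under a longest such one, which belongs to C(π) and therefore is σ; and
-- [1], 3142, 2413 lie below σ as well. Hence the defining sum of μ(π) is the sum of μ over [1, σ].

module Submission where

open import Defs
open import Relation.Binary.PropositionalEquality
open import Data.Nat
  using (ℕ; zero; suc; _<_; _≤_; _>_; _≤′_; ≤′-refl; ≤′-step; _<ᵇ_; _≡ᵇ_; z≤n; s≤s; s≤s⁻¹; _≟_)

open import Data.Bool using (Bool; true; false; _∧_; not; T; if_then_else_)
open import Data.Bool.ListAction using (all)
open import Data.Bool.Properties using (T-≡; ∨-zeroʳ; ∧-zeroʳ; ∧-identityʳ; ¬-not; not-involutive)
open import Data.Empty using (⊥; ⊥-elim)
open import Data.Integer using (ℤ; +_; -_; _+_)
open import Data.Integer.Properties
  using (+-identityˡ; +-identityʳ; +-assoc; +-inverseˡ; neg-involutive; +-commutativeSemigroup)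
open import Algebra.Properties.CommutativeSemigroup +-commutativeSemigroup using (interchange)
open import Data.List
  using (List; []; _∷_; map; _++_; length; zip; filter; filterᵇ; concat; concatMap; applyUpTo;
         takeWhile; dropWhile; head)
open import Data.List.Extrema.Nat using (argmax; argmax-all; f[xs]≤f[argmax])
open import Data.List.Membership.Propositional using (_∈_; _∉_; find; lose)
open import Data.List.Membership.Propositional.Properties
  using (∈-++⁺ˡ; ∈-++⁺ʳ; ∈-++⁻; ∈-map⁺; ∈-map⁻; ∈-concatMap⁺; ∈-concatMap⁻; ∈-insert;
         ∈-filter⁺; ∈-filter⁻; ∈-applyUpTo⁺; ∈-applyUpTo⁻)
open import Data.List.Properties
  using (≡-dec; length-++; ++-assoc; ++-identityʳ; map-++; concat-++; applyUpTo-∷ʳ;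
         ∷-injectiveˡ; ∷-injectiveʳ; filter-++; filter-reject; filter-all; takeWhile++dropWhile)
open import Data.List.Relation.Binary.Equality.Propositional using (≋⇒≡)
open import Data.List.Relation.Binary.Permutation.Propositional using (↭-sym; ↭⇒↭ₛ)
open import Data.List.Relation.Binary.Permutation.Propositional.Properties using (shift; ∈-resp-↭; ↭-length)
open import Data.List.Relation.Binary.Permutation.Setoid.Properties (setoid ℕ) using (Unique-resp-↭)
open import Data.List.Relation.Binary.Sublist.Propositional
  using (_⊆_; []; _∷_; _∷ʳ_; ⊆-refl; ⊆-trans; minimum; from∈)
open import Data.List.Relation.Binary.Sublist.Propositional.Properties
  using (length-mono-≤; to-≋; ++⁺ˡ; ++⁺ʳ; All-resp-⊆)
open import Data.List.Relation.Unary.All using (All; []; _∷_)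
import Data.List.Relation.Unary.All as All
open import Data.List.Relation.Unary.All.Properties
  using (¬Any⇒All¬; all-takeWhile; all-head-dropWhile; dropWhile⁻)
import Data.List.Relation.Unary.All.Properties as All
open import Data.List.Relation.Unary.AllPairs using ([]; _∷_)
open import Data.List.Relation.Unary.Any using (here; there)
open import Data.List.Relation.Unary.Any.Properties using (any⁺; any⁻)
open import Data.List.Relation.Unary.Unique.Propositional using (Unique)
import Data.List.Relation.Unary.Unique.Propositional.Properties as Unique
open import Data.Maybe.Relation.Unary.All using (just)
import Data.Maybe.Relation.Unary.All as Maybe
open import Data.Nat.Induction using (<-wellFounded)
open import Data.Nat.Properties
  using (≤-refl; ≤-trans; ≤-antisym; <-trans; <-irrefl; <-asym; <-cmp; _<?_; <⇒≤; <⇒≱; ≤∧≢⇒<; ≮⇒≥;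
         <-≤-trans; ≤⇒≤′; ≤′⇒≤; m<m+n; m≤n⇒m≤1+n; suc-injective; <ᵇ⇒<; <⇒<ᵇ; ≡⇒≡ᵇ; ≡ᵇ⇒≡)
open import Data.Product using (Σ; ∃₂; ∃-syntax; _×_; _,_; proj₁; proj₂)
open import Data.Sum using (_⊎_; inj₁; inj₂; [_,_]′; swap)
open import Data.Unit using (⊤; tt)
open import Function using (Equivalence; _∘_; flip; id)
open import Induction.WellFounded using (Acc; acc)
open import Relation.Binary.Definitions using (Decidable; Transitive; tri<; tri≈; tri>)
open import Relation.Nullary using (¬_; yes; no; ¬?)
open import Relation.Nullary.Decidable using (T?)

∧-true⁻ : ∀ a {b} → a ∧ b ≡ true → a ≡ true × b ≡ true
∧-true⁻ true e = refl , e

∧-true⁺ : ∀ {a b} → a ≡ true → b ≡ true → a ∧ b ≡ true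
∧-true⁺ refl refl = refl

true≢false : true ≢ false
true≢false ()

T⇒≡true : ∀ {b} → T b → b ≡ true
T⇒≡true = Equivalence.to T-≡

≡true⇒T : ∀ {b} → b ≡ true → T b
≡true⇒T = Equivalence.from T-≡

<ᵇ-true : ∀ {m n} → m < n → (m <ᵇ n) ≡ true
<ᵇ-true m<n = T⇒≡true (<⇒<ᵇ m<n)

<ᵇ-false : ∀ {m n} → n ≤ m → (m <ᵇ n) ≡ false
<ᵇ-false {m} {n} n≤m with m <ᵇ n in e
... | false = refl
... | true  = ⊥-elim (<⇒≱ (<ᵇ⇒< m n (≡true⇒T e)) n≤m)

eqList⇒≡ : ∀ a b → eqList a b ≡ true → a ≡ b
eqList⇒≡ []      []      _ = refl
eqList⇒≡ (x ∷ a) (y ∷ b) e with x≡y , a≡b ← ∧-true⁻ (x ≡ᵇ y) e =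
  cong₂ _∷_ (≡ᵇ⇒≡ x y (≡true⇒T x≡y)) (eqList⇒≡ a b a≡b)

eqList-refl : ∀ a → eqList a a ≡ true
eqList-refl []      = refl
eqList-refl (x ∷ a) rewrite T⇒≡true (≡⇒≡ᵇ x x refl) = eqList-refl a

≢⇒eqList-false : ∀ {a b} → a ≢ b → eqList a b ≡ false
≢⇒eqList-false {a} {b} a≢b with eqList a b in e
... | true  = ⊥-elim (a≢b (eqList⇒≡ a b e))
... | false = refl

[1] [3142] [2413] : List ℕ
[1]    = 1 ∷ []
[3142] = 3 ∷ 1 ∷ 4 ∷ 2 ∷ []
[2413] = 2 ∷ 4 ∷ 1 ∷ 3 ∷ []

SameOrder : ℕ → ℕ → ℕ → ℕ → Set
SameOrder x x′ y y′ = ((x <ᵇ x′) ≡ (y <ᵇ y′)) × ((x′ <ᵇ x) ≡ (y′ <ᵇ y))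

sameOrder⇒ : ∀ x x′ y y′ → sameOrder x x′ y y′ ≡ true → SameOrder x x′ y y′
sameOrder⇒ x x′ y y′ e with x <ᵇ x′ | y <ᵇ y′ | x′ <ᵇ x | y′ <ᵇ y
... | true  | true  | true  | true  = refl , refl
... | true  | true  | false | false = refl , refl
... | false | false | true  | true  = refl , refl
... | false | false | false | false = refl , refl
sameOrder⇒ x x′ y y′ () | true  | false | _     | _
sameOrder⇒ x x′ y y′ () | false | true  | _     | _
sameOrder⇒ x x′ y y′ () | true  | true  | true  | false
sameOrder⇒ x x′ y y′ () | true  | true  | false | true
sameOrder⇒ x x′ y y′ () | false | false | true  | false
sameOrder⇒ x x′ y y′ () | false | false | false | true

sameOrder⇐ : ∀ x x′ y y′ → SameOrder x x′ y y′ → sameOrder x x′ y y′ ≡ true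
sameOrder⇐ x x′ y y′ (e₁ , e₂) with x <ᵇ x′ | y <ᵇ y′ | x′ <ᵇ x | y′ <ᵇ y
sameOrder⇐ x x′ y y′ (refl , refl) | true  | _ | true  | _ = refl
sameOrder⇐ x x′ y y′ (refl , refl) | true  | _ | false | _ = refl
sameOrder⇐ x x′ y y′ (refl , refl) | false | _ | true  | _ = refl
sameOrder⇐ x x′ y y′ (refl , refl) | false | _ | false | _ = refl

SameOrder-< : ∀ {a b c d} → a < b → c < d → SameOrder a b c d
SameOrder-< a<b c<d =
  trans (<ᵇ-true a<b) (sym (<ᵇ-true c<d)) , trans (<ᵇ-false (<⇒≤ a<b)) (sym (<ᵇ-false (<⇒≤ c<d)))

SameOrder-> : ∀ {a b c d} → a > b → c > d → SameOrder a b c d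
SameOrder-> a>b c>d =
  trans (<ᵇ-false (<⇒≤ a>b)) (sym (<ᵇ-false (<⇒≤ c>d))) , trans (<ᵇ-true a>b) (sym (<ᵇ-true c>d))

AllSameOrder : ℕ → ℕ → List ℕ → List ℕ → Set
AllSameOrder x y []        []        = ⊤
AllSameOrder x y []        (_ ∷ _)   = ⊥
AllSameOrder x y (_ ∷ _)   []        = ⊥
AllSameOrder x y (x′ ∷ xs) (y′ ∷ ys) = SameOrder x x′ y y′ × AllSameOrder x y xs ys

OrderIso : List ℕ → List ℕ → Set
OrderIso []       []       = ⊤
OrderIso []       (_ ∷ _)  = ⊥
OrderIso (_ ∷ _)  []       = ⊥
OrderIso (x ∷ xs) (y ∷ ys) = OrderIso xs ys × AllSameOrder x y xs ys

allSameOrder⇒ : ∀ x y xs ys →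
  ((length xs ≡ᵇ length ys) ∧ all (λ p → sameOrder x (proj₁ p) y (proj₂ p)) (zip xs ys)) ≡ true →
  AllSameOrder x y xs ys
allSameOrder⇒ x y []        []        e = tt
allSameOrder⇒ x y (x′ ∷ xs) (y′ ∷ ys) e
  with len , rest ← ∧-true⁻ (length xs ≡ᵇ length ys) e
  with head , tail ← ∧-true⁻ (sameOrder x x′ y y′) rest
  = sameOrder⇒ x x′ y y′ head , allSameOrder⇒ x y xs ys (∧-true⁺ len tail)

allSameOrder⇐ : ∀ x y xs ys → AllSameOrder x y xs ys →
  ((length xs ≡ᵇ length ys) ∧ all (λ p → sameOrder x (proj₁ p) y (proj₂ p)) (zip xs ys)) ≡ true
allSameOrder⇐ x y []        []        _        = refl
allSameOrder⇐ x y (x′ ∷ xs) (y′ ∷ ys) (s , ss)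
  with len , rest ← ∧-true⁻ (length xs ≡ᵇ length ys) (allSameOrder⇐ x y xs ys ss)
  = ∧-true⁺ len (∧-true⁺ (sameOrder⇐ x x′ y y′ s) rest)

orderIso⇒ : ∀ p q → orderIso p q ≡ true → OrderIso p q
orderIso⇒ []       []       _ = tt
orderIso⇒ (x ∷ xs) (y ∷ ys) e with iso , same ← ∧-true⁻ (orderIso xs ys) e =
  orderIso⇒ xs ys iso , allSameOrder⇒ x y xs ys same

orderIso⇐ : ∀ p q → OrderIso p q → orderIso p q ≡ true
orderIso⇐ []       []       _          = refl
orderIso⇐ (x ∷ xs) (y ∷ ys) (iso , ss) = ∧-true⁺ (orderIso⇐ xs ys iso) (allSameOrder⇐ x y xs ys ss)

AllSameOrder-refl : ∀ x xs → AllSameOrder x x xs xs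
AllSameOrder-refl x []       = tt
AllSameOrder-refl x (_ ∷ xs) = (refl , refl) , AllSameOrder-refl x xs

AllSameOrder-trans : ∀ {x y z} xs ys zs →
  AllSameOrder x y xs ys → AllSameOrder y z ys zs → AllSameOrder x z xs zs
AllSameOrder-trans []       []       []       _          _          = tt
AllSameOrder-trans (_ ∷ xs) (_ ∷ ys) (_ ∷ zs) ((e₁ , e₂) , s) ((e₃ , e₄) , t) =
  (trans e₁ e₃ , trans e₂ e₄) , AllSameOrder-trans xs ys zs s t

OrderIso-refl : ∀ p → OrderIso p p
OrderIso-refl []       = tt
OrderIso-refl (x ∷ xs) = OrderIso-refl xs , AllSameOrder-refl x xs

OrderIso-trans : ∀ p q r → OrderIso p q → OrderIso q r → OrderIso p r
OrderIso-trans []       []       []       _          _          = tt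
OrderIso-trans (_ ∷ xs) (_ ∷ ys) (_ ∷ zs) (i , s) (j , t) =
  OrderIso-trans xs ys zs i j , AllSameOrder-trans xs ys zs s t

OrderIso-length : ∀ p q → OrderIso p q → length p ≡ length q
OrderIso-length []       []       _       = refl
OrderIso-length (_ ∷ xs) (_ ∷ ys) (i , _) = cong suc (OrderIso-length xs ys i)

-- The last component is the invariant that carries the induction.
OrderIso-⊆ : ∀ {s q} → s ⊆ q → ∀ t → OrderIso q t →
  ∃[ s′ ] s′ ⊆ t × OrderIso s s′ × (∀ x y → AllSameOrder x y q t → AllSameOrder x y s s′)
OrderIso-⊆ []          []      _       = [] , [] , tt , λ _ _ _ → tt
OrderIso-⊆ (_ ∷ʳ s⊆q)  (z ∷ t) (i , _)
  with s′ , s′⊆t , iso , keep ← OrderIso-⊆ s⊆q t i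
  = s′ , z ∷ʳ s′⊆t , iso , λ x y ss → keep x y (proj₂ ss)
OrderIso-⊆ (refl ∷ s⊆q) (z ∷ t) (i , ss)
  with s′ , s′⊆t , iso , keep ← OrderIso-⊆ s⊆q t i
  = z ∷ s′ , refl ∷ s′⊆t , (iso , keep _ z ss) , λ x y ss′ → proj₁ ss′ , keep x y (proj₂ ss′)

AllSameOrder-sym : ∀ {x y} xs ys → AllSameOrder x y xs ys → AllSameOrder y x ys xs
AllSameOrder-sym []       []       _                 = tt
AllSameOrder-sym (_ ∷ xs) (_ ∷ ys) ((e₁ , e₂) , ss) = (sym e₁ , sym e₂) , AllSameOrder-sym xs ys ss

AllSameOrder-find : ∀ {x y} xs c₁ z c₂ → AllSameOrder x y xs (c₁ ++ z ∷ c₂) →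
  ∃[ v ] v ∈ xs × SameOrder x v y z
AllSameOrder-find (v ∷ xs) []       z c₂ (s , _)  = v , here refl , s
AllSameOrder-find (_ ∷ xs) (_ ∷ c₁) z c₂ (_ , ss) with v , v∈ , s ← AllSameOrder-find xs c₁ z c₂ ss =
  v , there v∈ , s

AllSameOrder-remove : ∀ {x y} a₁ a b₁ b {a₂ b₂} → length a₁ ≡ length b₁ →
  AllSameOrder x y (a₁ ++ a ∷ a₂) (b₁ ++ b ∷ b₂) → AllSameOrder x y (a₁ ++ a₂) (b₁ ++ b₂)
AllSameOrder-remove []       a []       b _   (_ , ss) = ss
AllSameOrder-remove (_ ∷ a₁) a (_ ∷ b₁) b len (s , ss) =
  s , AllSameOrder-remove a₁ a b₁ b (suc-injective len) ss

¬SameOrder-max : ∀ {M v y} → v < M → y < M → ¬ SameOrder M v y M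
¬SameOrder-max v<M y<M (e , _) = true≢false (trans (sym (<ᵇ-true y<M)) (trans (sym e) (<ᵇ-false (<⇒≤ v<M))))

OrderIso-removeMax : ∀ M a₁ a₂ b₁ b₂ → (∀ {v} → v ∈ a₁ ++ a₂ → v < M) → (∀ {v} → v ∈ b₁ ++ b₂ → v < M) →
  OrderIso (a₁ ++ M ∷ a₂) (b₁ ++ M ∷ b₂) → length a₁ ≡ length b₁ × OrderIso (a₁ ++ a₂) (b₁ ++ b₂)
OrderIso-removeMax M [] a₂ [] b₂ _ _ (iso , _) = refl , iso
OrderIso-removeMax M (x ∷ a₁) a₂ (y ∷ b₁) b₂ <M <M′ (iso , ss)
  with len , iso′ ← OrderIso-removeMax M a₁ a₂ b₁ b₂ (<M ∘ there) (<M′ ∘ there) iso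
  = cong suc len , iso′ , AllSameOrder-remove a₁ M b₁ M len ss
OrderIso-removeMax M [] a₂ (y ∷ b₁) b₂ <M <M′ (_ , ss)
  with v , v∈ , s ← AllSameOrder-find a₂ b₁ M b₂ ss
  = ⊥-elim (¬SameOrder-max (<M v∈) (<M′ (here refl)) s)
OrderIso-removeMax M (x ∷ a₁) a₂ [] b₂ <M <M′ (_ , ss)
  with v , v∈ , s ← AllSameOrder-find b₂ a₁ M a₂ (AllSameOrder-sym (a₁ ++ M ∷ a₂) b₂ ss)
  = ⊥-elim (¬SameOrder-max (<M′ v∈) (<M (here refl)) s)

insert-cong : ∀ (x : ℕ) a₁ a₂ b₁ b₂ → length a₁ ≡ length b₁ → a₁ ++ a₂ ≡ b₁ ++ b₂ →
  a₁ ++ x ∷ a₂ ≡ b₁ ++ x ∷ b₂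
insert-cong x []       a₂ []       b₂ _   refl = refl
insert-cong x (_ ∷ a₁) a₂ (_ ∷ b₁) b₂ len eq =
  cong₂ _∷_ (∷-injectiveˡ eq) (insert-cong x a₁ a₂ b₁ b₂ (suc-injective len) (∷-injectiveʳ eq))

Contains : List ℕ → List ℕ → Set
Contains p q = ∃[ s ] s ⊆ q × OrderIso p s

∈subseqs⇒⊆ : ∀ q {s} → s ∈ subseqs q → s ⊆ q
∈subseqs⇒⊆ []      (here refl) = []
∈subseqs⇒⊆ (x ∷ q) s∈ with ∈-++⁻ (map (x ∷_) (subseqs q)) s∈
... | inj₂ s∈′ = x ∷ʳ ∈subseqs⇒⊆ q s∈′
... | inj₁ s∈′ with _ , s∈″ , refl ← ∈-map⁻ (x ∷_) s∈′ = refl ∷ ∈subseqs⇒⊆ q s∈″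

⊆⇒∈subseqs : ∀ {s q} → s ⊆ q → s ∈ subseqs q
⊆⇒∈subseqs []                  = here refl
⊆⇒∈subseqs (_∷ʳ_ {ys = q} y s⊆q) = ∈-++⁺ʳ (map (y ∷_) (subseqs q)) (⊆⇒∈subseqs s⊆q)
⊆⇒∈subseqs (refl ∷ s⊆q)        = ∈-++⁺ˡ (∈-map⁺ (_ ∷_) (⊆⇒∈subseqs s⊆q))

contains⇒ : ∀ p q → contains p q ≡ true → Contains p q
contains⇒ p q e with s , s∈ , iso ← find (any⁻ (orderIso p) (subseqs q) (≡true⇒T e)) =
  s , ∈subseqs⇒⊆ q s∈ , orderIso⇒ p s (T⇒≡true iso)

contains⇐ : ∀ p q → Contains p q → contains p q ≡ true
contains⇐ p q (s , s⊆q , iso) =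
  T⇒≡true (any⁺ (orderIso p) (lose (⊆⇒∈subseqs s⊆q) (≡true⇒T (orderIso⇐ p s iso))))

Contains-trans : ∀ p q r → Contains p q → Contains q r → Contains p r
Contains-trans p q r (s , s⊆q , p≅s) (t , t⊆r , q≅t)
  with s′ , s′⊆t , s≅s′ , _ ← OrderIso-⊆ s⊆q t q≅t
  = s′ , ⊆-trans s′⊆t t⊆r , OrderIso-trans p s s′ p≅s s≅s′

contains-trans : ∀ p q r → contains p q ≡ true → contains q r ≡ true → contains p r ≡ true
contains-trans p q r pq qr = contains⇐ p r (Contains-trans p q r (contains⇒ p q pq) (contains⇒ q r qr))

contains-refl : ∀ p → contains p p ≡ true
contains-refl p = contains⇐ p p (p , ⊆-refl , OrderIso-refl p)

contains-length : ∀ p q → contains p q ≡ true → length p ≤ length q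
contains-length p q pq with s , s⊆q , p≅s ← contains⇒ p q pq
  rewrite OrderIso-length p s p≅s = length-mono-≤ s⊆q

contains-sameLength : ∀ p q → contains p q ≡ true → length p ≡ length q → OrderIso p q
contains-sameLength p q pq len with s , s⊆q , p≅s ← contains⇒ p q pq
  with refl ← ≋⇒≡ (to-≋ (trans (sym (OrderIso-length p s p≅s)) len) s⊆q) = p≅s

contains-[1] : ∀ x xs → contains [1] (x ∷ xs) ≡ true
contains-[1] x xs = contains⇐ [1] (x ∷ xs) (x ∷ [] , refl ∷ minimum xs , tt , tt)

∈-insert⁻ : ∀ {v x : ℕ} p₁ p₂ → v ∈ p₁ ++ x ∷ p₂ → v ≡ x ⊎ v ∈ p₁ ++ p₂
∈-insert⁻ {x = x} p₁ p₂ v∈ with ∈-resp-↭ (shift x p₁ p₂) v∈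
... | here v≡x  = inj₁ v≡x
... | there v∈′ = inj₂ v∈′

∈-insert⁺ : ∀ {v x : ℕ} p₁ p₂ → v ∈ p₁ ++ p₂ → v ∈ p₁ ++ x ∷ p₂
∈-insert⁺ {x = x} p₁ p₂ v∈ = ∈-resp-↭ (↭-sym (shift x p₁ p₂)) (there v∈)

∈insertEverywhere⁻ : ∀ x ys {z} → z ∈ insertEverywhere x ys →
  ∃₂ λ p₁ p₂ → ys ≡ p₁ ++ p₂ × z ≡ p₁ ++ x ∷ p₂
∈insertEverywhere⁻ x []       (here refl) = [] , [] , refl , refl
∈insertEverywhere⁻ x (y ∷ ys) (here refl) = [] , y ∷ ys , refl , refl
∈insertEverywhere⁻ x (y ∷ ys) (there z∈)
  with _ , z∈′ , refl ← ∈-map⁻ (y ∷_) z∈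
  with p₁ , p₂ , refl , refl ← ∈insertEverywhere⁻ x ys z∈′
  = y ∷ p₁ , p₂ , refl , refl

∈S-suc⁻ : ∀ n {z} → z ∈ S (suc n) → ∃₂ λ p₁ p₂ → p₁ ++ p₂ ∈ S n × z ≡ p₁ ++ suc n ∷ p₂
∈S-suc⁻ n z∈
  with ys , ys∈ , z∈′ ← find (∈-concatMap⁻ (insertEverywhere (suc n)) {xs = S n} z∈)
  with p₁ , p₂ , refl , refl ← ∈insertEverywhere⁻ (suc n) ys z∈′
  = p₁ , p₂ , ys∈ , refl

∈S⇒length : ∀ n {z} → z ∈ S n → length z ≡ n
∈S⇒length zero    (here refl) = refl
∈S⇒length (suc n) z∈ with p₁ , p₂ , ys∈ , refl ← ∈S-suc⁻ n z∈ =
  trans (↭-length (shift (suc n) p₁ p₂)) (cong suc (∈S⇒length n ys∈))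

∈S⇒bounded : ∀ n {z v} → z ∈ S n → v ∈ z → 1 ≤ v × v ≤ n
∈S⇒bounded zero    (here refl) ()
∈S⇒bounded (suc n) z∈ v∈ with p₁ , p₂ , ys∈ , refl ← ∈S-suc⁻ n z∈ with ∈-insert⁻ p₁ p₂ v∈
... | inj₁ refl = s≤s z≤n , ≤-refl
... | inj₂ v∈′  with 1≤v , v≤n ← ∈S⇒bounded n ys∈ v∈′ = 1≤v , m≤n⇒m≤1+n v≤n

∈S⇒complete : ∀ n {z v} → z ∈ S n → 1 ≤ v → v ≤ n → v ∈ z
∈S⇒complete zero    _ (s≤s _) ()
∈S⇒complete (suc n) {v = v} z∈ 1≤v v≤1+n with p₁ , p₂ , ys∈ , refl ← ∈S-suc⁻ n z∈ with v ≟ suc n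
... | yes refl = ∈-insert p₁
... | no  v≢   = ∈-insert⁺ p₁ p₂ (∈S⇒complete n ys∈ 1≤v (s≤s⁻¹ (≤∧≢⇒< v≤1+n v≢)))

∈S⇒<suc : ∀ n {ys v} → ys ∈ S n → v ∈ ys → v < suc n
∈S⇒<suc n ys∈ v∈ = s≤s (proj₂ (∈S⇒bounded n ys∈ v∈))

suc∉S : ∀ n {ys} → ys ∈ S n → suc n ∉ ys
suc∉S n ys∈ m∈ = <-irrefl refl (∈S⇒<suc n ys∈ m∈)

∈S⇒Unique : ∀ n {z} → z ∈ S n → Unique z
∈S⇒Unique zero    (here refl) = []
∈S⇒Unique (suc n) z∈ with p₁ , p₂ , ys∈ , refl ← ∈S-suc⁻ n z∈ =
  Unique-resp-↭ (↭⇒↭ₛ (↭-sym (shift (suc n) p₁ p₂)))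
    (¬Any⇒All¬ (p₁ ++ p₂) (suc∉S n ys∈) ∷ ∈S⇒Unique n ys∈)

S-orderIso⇒≡ : ∀ n {a b} → a ∈ S n → b ∈ S n → OrderIso a b → a ≡ b
S-orderIso⇒≡ zero    (here refl) (here refl) _ = refl
S-orderIso⇒≡ (suc n) a∈ b∈ iso
  with a₁ , a₂ , as∈ , refl ← ∈S-suc⁻ n a∈
  with b₁ , b₂ , bs∈ , refl ← ∈S-suc⁻ n b∈
  with len , iso′ ← OrderIso-removeMax (suc n) a₁ a₂ b₁ b₂ (∈S⇒<suc n as∈) (∈S⇒<suc n bs∈) iso
  = insert-cong (suc n) a₁ a₂ b₁ b₂ len (S-orderIso⇒≡ n as∈ bs∈ iso′)

S-≺⇒< : ∀ l m {a b} → a ∈ S l → b ∈ S m → a ≺ b → l < m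
S-≺⇒< l m {a} {b} a∈ b∈ (ab , a≢b) with l ≟ m
... | no  l≢m  = ≤∧≢⇒< (subst₂ _≤_ (∈S⇒length l a∈) (∈S⇒length m b∈) (contains-length a b ab)) l≢m
... | yes refl = ⊥-elim (a≢b (S-orderIso⇒≡ l a∈ b∈
                   (contains-sameLength a b ab (trans (∈S⇒length l a∈) (sym (∈S⇒length l b∈))))))

Unique-concatMap : ∀ {A B : Set} (f : A → List B) {xs} → Unique xs → (∀ {x} → x ∈ xs → Unique (f x)) →
  (∀ {x y z} → x ∈ xs → y ∈ xs → z ∈ f x → z ∈ f y → x ≡ y) → Unique (concatMap f xs)
Unique-concatMap f {[]}     _          _      _   = []
Unique-concatMap f {x ∷ xs} (x∉ ∷ uxs) unique inj =
  Unique.++⁺ (unique (here refl))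
    (Unique-concatMap f uxs (unique ∘ there) λ y∈ y′∈ → inj (there y∈) (there y′∈))
    λ (z∈fx , z∈rest) → let y , y∈ , z∈fy = find (∈-concatMap⁻ f {xs = xs} z∈rest) in
      All.lookup x∉ y∈ (inj (here refl) (there y∈) z∈fx z∈fy)

Unique-insertEverywhere : ∀ x ys → x ∉ ys → Unique (insertEverywhere x ys)
Unique-insertEverywhere x []       _  = [] ∷ []
Unique-insertEverywhere x (y ∷ ys) x∉ =
  All.map⁺ (All.tabulate λ _ eq → x∉ (here (∷-injectiveˡ eq))) ∷
  Unique.map⁺ ∷-injectiveʳ (Unique-insertEverywhere x ys (x∉ ∘ there))

-- Both lists are recovered from z by deleting M.
insertEverywhere-injective : ∀ M {ys ys′ z} → M ∉ ys → M ∉ ys′ →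
  z ∈ insertEverywhere M ys → z ∈ insertEverywhere M ys′ → ys ≡ ys′
insertEverywhere-injective M {ys} {ys′} M∉ M∉′ z∈ z∈′
  with p₁ , p₂ , refl , refl ← ∈insertEverywhere⁻ M ys z∈
  with q₁ , q₂ , refl , eq   ← ∈insertEverywhere⁻ M ys′ z∈′
  = trans (sym (deleteM p₁ p₂ M∉)) (trans (cong (filter (λ v → ¬? (v ≟ M))) eq) (deleteM q₁ q₂ M∉′))
  where
  deleteM : ∀ p₁ p₂ → M ∉ p₁ ++ p₂ → filter (λ v → ¬? (v ≟ M)) (p₁ ++ M ∷ p₂) ≡ p₁ ++ p₂
  deleteM p₁ p₂ M∉ = begin
    filter P? (p₁ ++ M ∷ p₂)         ≡⟨ filter-++ P? p₁ (M ∷ p₂) ⟩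
    filter P? p₁ ++ filter P? (M ∷ p₂) ≡⟨ cong (filter P? p₁ ++_) (filter-reject P? (λ M≢M → M≢M refl)) ⟩
    filter P? p₁ ++ filter P? p₂     ≡⟨ filter-++ P? p₁ p₂ ⟨
    filter P? (p₁ ++ p₂)             ≡⟨ filter-all P? (All.map (_∘ sym) (¬Any⇒All¬ (p₁ ++ p₂) M∉)) ⟩
    p₁ ++ p₂                         ∎
    where
    open ≡-Reasoning
    P? = λ v → ¬? (v ≟ M)

Unique-S : ∀ n → Unique (S n)
Unique-S zero    = [] ∷ []
Unique-S (suc n) = Unique-concatMap (insertEverywhere (suc n)) (Unique-S n)
  (λ ys∈ → Unique-insertEverywhere (suc n) _ (suc∉S n ys∈))
  (λ ys∈ ys′∈ → insertEverywhere-injective (suc n) (suc∉S n ys∈) (suc∉S n ys′∈))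

⪯-≺-trans : ∀ k n {γ σ π} → σ ∈ S k → π ∈ S n → contains γ σ ≡ true → σ ≺ π → γ ≺ π
⪯-≺-trans k n {γ} {σ} {π} σ∈ π∈ γσ σ≺π = contains-trans γ σ π γσ (proj₁ σ≺π) , γ≢π
  where
  γ≢π : γ ≢ π
  γ≢π refl = <⇒≱ (S-≺⇒< k n σ∈ π∈ σ≺π) (subst₂ _≤_ (∈S⇒length n π∈) (∈S⇒length k σ∈) (contains-length π σ γσ))

∈K⁻ : ∀ l {z} → z ∈ K l → z ∈ S l × noAdj z ≡ true
∈K⁻ l z∈ with z∈S , t ← ∈-filter⁻ (T? ∘ noAdj) {xs = S l} z∈ = z∈S , T⇒≡true t

∈K⇒∈S : ∀ l {z} → z ∈ K l → z ∈ S l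
∈K⇒∈S l = proj₁ ∘ ∈K⁻ l

∈K⇒length : ∀ l {z} → z ∈ K l → length z ≡ l
∈K⇒length l = ∈S⇒length l ∘ ∈K⇒∈S l

∈Kupto⁻ : ∀ m {z} → z ∈ Kupto m → ∃[ l ] 1 ≤ l × l ≤ m × z ∈ K l
∈Kupto⁻ m z∈
  with i , i∈ , z∈K ← find (∈-concatMap⁻ (λ i → K (suc i)) {xs = applyUpTo id m} z∈)
  with _ , i<m , refl ← ∈-applyUpTo⁻ id i∈
  = suc i , s≤s z≤n , i<m , z∈K

∈Kupto⁺ : ∀ m l {z} → 1 ≤ l → l ≤ m → z ∈ K l → z ∈ Kupto m
∈Kupto⁺ m (suc i) _ l≤m z∈ =
  ∈-concatMap⁺ (λ i → K (suc i)) (lose (∈-applyUpTo⁺ id l≤m) z∈)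

Unique-Kupto : ∀ m → Unique (Kupto m)
Unique-Kupto m = Unique-concatMap (λ i → K (suc i)) (Unique.upTo⁺ m)
  (λ {i} _ → Unique.filter⁺ (T? ∘ noAdj) (Unique-S (suc i)))
  (λ {i} {j} _ _ z∈ z∈′ → suc-injective (trans (sym (∈K⇒length (suc i) z∈)) (∈K⇒length (suc j) z∈′)))

-- Separable permutations

AllBelow : (ℕ → ℕ → Set) → List ℕ → List ℕ → Set
AllBelow _⊏_ s t = ∀ {i j} → i ∈ s → j ∈ t → i ⊏ j

Decomposition : (ℕ → ℕ → Set) → List ℕ → Set
Decomposition _⊏_ p = ∃[ a ] ∃[ u ] ∃[ b ] ∃[ v ]
  p ≡ (a ∷ u) ++ (b ∷ v) × (AllBelow _⊏_ (a ∷ u) (b ∷ v) ⊎ AllBelow _⊏_ (b ∷ v) (a ∷ u))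

-- With _⊏_ = _<_ this is avoidance of 3142, with _⊏_ = _>_ avoidance of 2413.
Avoids3142 : (ℕ → ℕ → Set) → List ℕ → Set
Avoids3142 _⊏_ p = ∀ {w x y z} → w ∷ x ∷ y ∷ z ∷ [] ⊆ p → x ⊏ z → z ⊏ w → w ⊏ y → ⊥

Avoids3142-⊆ : ∀ {_⊏_ p q} → q ⊆ p → Avoids3142 _⊏_ p → Avoids3142 _⊏_ q
Avoids3142-⊆ q⊆p avoid sub = avoid (⊆-trans sub q⊆p)

≢⇒<⊎> : ∀ {m n} → m ≢ n → m < n ⊎ m > n
≢⇒<⊎> {m} {n} m≢n with <-cmp m n
... | tri< m<n _ _ = inj₁ m<n
... | tri≈ _ m≡n _ = ⊥-elim (m≢n m≡n)
... | tri> _ _ m>n = inj₂ m>n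

module _ {_⊏_ : ℕ → ℕ → Set} (_⊏?_ : Decidable _⊏_) (⊏-trans : Transitive _⊏_)
         (⊏-connex : ∀ {m n} → m ≢ n → m ⊏ n ⊎ n ⊏ m) where

  -- β is cut after its longest prefix P below x. If something follows, its first entry h lies
  -- above x, and so does every later entry q: otherwise x a h q would be a 3142.
  Decomposition-∷ : ∀ {x t} a u b v → t ≡ (a ∷ u) ++ (b ∷ v) → All (x ≢_) t →
    Avoids3142 _⊏_ (x ∷ t) → AllBelow _⊏_ (a ∷ u) (b ∷ v) → Decomposition _⊏_ (x ∷ t)
  Decomposition-∷ {x} a u b v refl x∉ avoid α⊏β with dropWhile (_⊏? x) (b ∷ v) in eq
  ... | [] = x , [] , a , u ++ b ∷ v , refl , inj₂ below
    where
    β⊏x : All (_⊏ x) (b ∷ v)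
    β⊏x = dropWhile⁻ (_⊏? x) eq
    below : AllBelow _⊏_ ((a ∷ u) ++ b ∷ v) (x ∷ [])
    below i∈ (here refl) with ∈-++⁻ (a ∷ u) i∈
    ... | inj₁ i∈α = ⊏-trans (α⊏β i∈α (here refl)) (All.lookup β⊏x (here refl))
    ... | inj₂ i∈β = All.lookup β⊏x i∈β
  ... | h ∷ Q = x , (a ∷ u) ++ P , h , Q , split , inj₁ below
    where
    P = takeWhile (_⊏? x) (b ∷ v)
    β≡ : P ++ h ∷ Q ≡ b ∷ v
    β≡ = trans (cong (P ++_) (sym eq)) (takeWhile++dropWhile (_⊏? x) (b ∷ v))
    split : x ∷ (a ∷ u) ++ b ∷ v ≡ (x ∷ (a ∷ u) ++ P) ++ h ∷ Q
    split = cong (x ∷_) (trans (cong ((a ∷ u) ++_) (sym β≡)) (sym (++-assoc (a ∷ u) P (h ∷ Q))))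
    ∈β : ∀ {j} → j ∈ P ++ h ∷ Q → j ∈ b ∷ v
    ∈β = subst (_ ∈_) β≡
    x≢ : ∀ {j} → j ∈ P ++ h ∷ Q → x ≢ j
    x≢ j∈ = All.lookup x∉ (∈-++⁺ʳ (a ∷ u) (∈β j∈))
    ¬h⊏x : ¬ h ⊏ x
    ¬h⊏x with just ¬h⊏x ← subst (Maybe.All (λ y → ¬ y ⊏ x) ∘ head) eq (all-head-dropWhile (_⊏? x) (b ∷ v))
      = ¬h⊏x
    x⊏h : x ⊏ h
    x⊏h = [ (λ x⊏h → x⊏h) , (λ h⊏x → ⊥-elim (¬h⊏x h⊏x)) ]′ (⊏-connex (x≢ (∈-++⁺ʳ P (here refl))))
    x⊏Q : ∀ {q} → q ∈ Q → x ⊏ q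
    x⊏Q q∈ with ⊏-connex (x≢ (∈-++⁺ʳ P (there q∈)))
    ... | inj₁ x⊏q = x⊏q
    ... | inj₂ q⊏x = ⊥-elim (avoid xahq (α⊏β (here refl) (∈β (∈-++⁺ʳ P (there q∈)))) q⊏x x⊏h)
      where
      xahq : x ∷ a ∷ h ∷ _ ∷ [] ⊆ x ∷ (a ∷ u) ++ b ∷ v
      xahq = refl ∷ refl ∷ ++⁺ˡ u (subst (_ ⊆_) β≡ (++⁺ˡ P (refl ∷ from∈ q∈)))
    x⊏hQ : ∀ {j} → j ∈ h ∷ Q → x ⊏ j
    x⊏hQ (here refl) = x⊏h
    x⊏hQ (there q∈) = x⊏Q q∈
    below : AllBelow _⊏_ (x ∷ (a ∷ u) ++ P) (h ∷ Q)
    below (here refl) j∈ = x⊏hQ j∈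
    below (there i∈)  j∈ with ∈-++⁻ (a ∷ u) i∈
    ... | inj₁ i∈α = α⊏β i∈α (∈β (∈-++⁺ʳ P j∈))
    ... | inj₂ i∈P = ⊏-trans (All.lookup (all-takeWhile (_⊏? x) (b ∷ v)) i∈P) (x⊏hQ j∈)

Decomposition->⇒< : ∀ {p} → Decomposition _>_ p → Decomposition _<_ p
Decomposition->⇒< (a , u , b , v , eq , inj₁ α>β) = a , u , b , v , eq , inj₂ λ j∈ i∈ → α>β i∈ j∈
Decomposition->⇒< (a , u , b , v , eq , inj₂ β>α) = a , u , b , v , eq , inj₁ λ i∈ j∈ → β>α j∈ i∈

separable⇒Decomposition : ∀ p → Unique p → 2 ≤ length p →
  Avoids3142 _<_ p → Avoids3142 _>_ p → Decomposition _<_ p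
separable⇒Decomposition (x ∷ []) _ (s≤s ()) _ _
separable⇒Decomposition (x ∷ y ∷ []) ((x≢y ∷ _) ∷ _) _ _ _ with ≢⇒<⊎> x≢y
... | inj₁ x<y = x , [] , y , [] , refl , inj₁ λ { (here refl) (here refl) → x<y }
... | inj₂ x>y = x , [] , y , [] , refl , inj₂ λ { (here refl) (here refl) → x>y }
separable⇒Decomposition (x ∷ t@(_ ∷ _ ∷ _)) (x∉ ∷ ut) _ av< av>
  with a , u , b , v , eq , ord ← separable⇒Decomposition t ut (s≤s (s≤s z≤n))
                                    (Avoids3142-⊆ (x ∷ʳ ⊆-refl) av<) (Avoids3142-⊆ (x ∷ʳ ⊆-refl) av>)
  with ord
... | inj₁ α<β = Decomposition-∷ _<?_ <-trans ≢⇒<⊎> a u b v eq x∉ av< α<β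
... | inj₂ β<α = Decomposition->⇒< (Decomposition-∷ (flip _<?_) (flip <-trans) (swap ∘ ≢⇒<⊎>)
                   a u b v eq x∉ av> λ i∈ j∈ → β<α j∈ i∈)

Unique-resp-⊇ : ∀ {xs ys : List ℕ} → xs ⊆ ys → Unique ys → Unique xs
Unique-resp-⊇ []             _         = []
Unique-resp-⊇ (_ ∷ʳ xs⊆ys)   (_ ∷ uys) = Unique-resp-⊇ xs⊆ys uys
Unique-resp-⊇ (refl ∷ xs⊆ys) (x∉ ∷ uys) = All-resp-⊆ xs⊆ys x∉ ∷ Unique-resp-⊇ xs⊆ys uys

Between : ℕ → ℕ → ℕ → Set
Between s z t = (s < z × z < t) ⊎ (t < z × z < s)

¬Between-left : ∀ {s t} → ¬ Between s s t
¬Between-left (inj₁ (s<s , _)) = <-irrefl refl s<s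
¬Between-left (inj₂ (_ , s<s)) = <-irrefl refl s<s

¬Between-right : ∀ {s t} → ¬ Between s t t
¬Between-right (inj₁ (_ , t<t)) = <-irrefl refl t<t
¬Between-right (inj₂ (t<t , _)) = <-irrefl refl t<t

¬Between-apart : ∀ {α β s t z} → AllBelow _<_ α β ⊎ AllBelow _<_ β α → s ∈ β → t ∈ β → z ∈ α → ¬ Between s z t
¬Between-apart (inj₁ α<β) s∈ t∈ z∈ (inj₁ (s<z , _)) = <-asym s<z (α<β z∈ s∈)
¬Between-apart (inj₁ α<β) s∈ t∈ z∈ (inj₂ (t<z , _)) = <-asym t<z (α<β z∈ t∈)
¬Between-apart (inj₂ β<α) s∈ t∈ z∈ (inj₁ (_ , z<t)) = <-asym z<t (β<α t∈ z∈)
¬Between-apart (inj₂ β<α) s∈ t∈ z∈ (inj₂ (_ , z<s)) = <-asym z<s (β<α s∈ z∈)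

length-<-++∷ : ∀ (xs : List ℕ) y ys → length xs < length (xs ++ y ∷ ys)
length-<-++∷ xs y ys rewrite length-++ xs {y ∷ ys} = m<m+n (length xs) (s≤s z≤n)

Bond : List ℕ → Set
Bond p = ∃[ p₁ ] ∃[ s ] ∃[ t ] ∃[ p₂ ] p ≡ p₁ ++ s ∷ t ∷ p₂ × (∀ {z} → z ∈ p → ¬ Between s z t)

separable⇒Bond : ∀ p → Acc _<_ (length p) → Unique p → 2 ≤ length p →
  Avoids3142 _<_ p → Avoids3142 _>_ p → Bond p
separable⇒Bond p (acc rec) up 2≤ av< av> with separable⇒Decomposition p up 2≤ av< av>
... | a , [] , b , [] , refl , _ =
  [] , a , b , [] , refl , λ { (here refl) → ¬Between-left ; (there (here refl)) → ¬Between-right }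
... | a , [] , b , v@(_ ∷ _) , refl , ord
  with q₁ , s , t , q₂ , β≡ , none ← separable⇒Bond (b ∷ v) (rec ≤-refl) (Unique-resp-⊇ (a ∷ʳ ⊆-refl) up)
                                      (s≤s (s≤s z≤n)) (Avoids3142-⊆ (a ∷ʳ ⊆-refl) av<)
                                      (Avoids3142-⊆ (a ∷ʳ ⊆-refl) av>)
  = a ∷ q₁ , s , t , q₂ , cong (a ∷_) β≡ ,
    λ { (here refl) → ¬Between-apart ord (subst (s ∈_) (sym β≡) (∈-insert q₁))
                        (subst (t ∈_) (sym β≡) (∈-++⁺ʳ q₁ (there (here refl)))) (here refl)
      ; (there z∈) → none z∈ }
... | a , u@(_ ∷ _) , b , v , refl , ord
  with q₁ , s , t , q₂ , α≡ , none ← separable⇒Bond (a ∷ u) (rec (length-<-++∷ (a ∷ u) b v))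
                                       (Unique-resp-⊇ (++⁺ʳ (b ∷ v) ⊆-refl) up) (s≤s (s≤s z≤n))
                                       (Avoids3142-⊆ (++⁺ʳ (b ∷ v) ⊆-refl) av<)
                                       (Avoids3142-⊆ (++⁺ʳ (b ∷ v) ⊆-refl) av>)
  = q₁ , s , t , q₂ ++ b ∷ v , trans (cong (_++ b ∷ v) α≡) (++-assoc q₁ (s ∷ t ∷ q₂) (b ∷ v)) , noneBetween
  where
  noneBetween : ∀ {z} → z ∈ (a ∷ u) ++ b ∷ v → ¬ Between s z t
  noneBetween z∈ with ∈-++⁻ (a ∷ u) z∈
  ... | inj₁ z∈α = none z∈α
  ... | inj₂ z∈β = ¬Between-apart (swap ord) (subst (s ∈_) (sym α≡) (∈-insert q₁))
                     (subst (t ∈_) (sym α≡) (∈-++⁺ʳ q₁ (there (here refl)))) z∈β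

noAdj-middle : ∀ p₁ a b p₂ → noAdj (p₁ ++ a ∷ b ∷ p₂) ≡ true → notAdjacentValues a b ≡ true
noAdj-middle []           a b p₂ e = proj₁ (∧-true⁻ (notAdjacentValues a b) e)
noAdj-middle (x ∷ [])     a b p₂ e = noAdj-middle [] a b p₂ (proj₂ (∧-true⁻ (notAdjacentValues x a) e))
noAdj-middle (x ∷ y ∷ p₁) a b p₂ e = noAdj-middle (y ∷ p₁) a b p₂ (proj₂ (∧-true⁻ (notAdjacentValues x y) e))

notAdjacentValues-ascending : ∀ a → notAdjacentValues a (suc a) ≡ false
notAdjacentValues-ascending a rewrite T⇒≡true (≡⇒≡ᵇ a a refl) = refl

notAdjacentValues-descending : ∀ a → notAdjacentValues (suc a) a ≡ false
notAdjacentValues-descending a rewrite T⇒≡true (≡⇒≡ᵇ a a refl) | ∨-zeroʳ (suc (suc a) ≡ᵇ a) = refl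

-- s + 1 is an entry of p, and it may not lie strictly between s and t.
noneBetween⇒suc : ∀ l {p s t} → p ∈ S l → t ∈ p → (∀ {z} → z ∈ p → ¬ Between s z t) → s < t → t ≡ suc s
noneBetween⇒suc l p∈ t∈ none s<t = ≤-antisym (≮⇒≥ λ 1+s<t → none (1+s∈ 1+s<t) (inj₁ (≤-refl , 1+s<t))) s<t
  where
  1+s∈ = λ 1+s<t → ∈S⇒complete l p∈ (s≤s z≤n) (≤-trans s<t (proj₂ (∈S⇒bounded l p∈ t∈)))

Bond⇒¬noAdj : ∀ l {p} → p ∈ S l → Bond p → noAdj p ≢ true
Bond⇒¬noAdj l p∈ (p₁ , s , t , p₂ , refl , none) noAdj≡
  with (s≢t ∷ _) ∷ _ ← Unique-resp-⊇ (++⁺ˡ p₁ (refl ∷ refl ∷ minimum p₂)) (∈S⇒Unique l p∈)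
  with ≢⇒<⊎> s≢t
... | inj₁ s<t with refl ← noneBetween⇒suc l p∈ (∈-++⁺ʳ p₁ (there (here refl))) none s<t =
  true≢false (trans (sym (noAdj-middle p₁ s (suc s) p₂ noAdj≡)) (notAdjacentValues-ascending s))
... | inj₂ s>t with refl ← noneBetween⇒suc l p∈ (∈-insert p₁) (λ z∈ → none z∈ ∘ swap) s>t =
  true≢false (trans (sym (noAdj-middle p₁ (suc t) t p₂ noAdj≡)) (notAdjacentValues-descending t))

3142-occurrence : ∀ {p w x y z} → w ∷ x ∷ y ∷ z ∷ [] ⊆ p → x < z → z < w → w < y → contains [3142] p ≡ true
3142-occurrence {p} {w} {x} {y} {z} sub x<z z<w w<y = contains⇐ [3142] p (_ , sub , iso)
  where
  iso : OrderIso [3142] (w ∷ x ∷ y ∷ z ∷ [])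
  iso = (((tt , tt) , SameOrder-> (<ᵇ⇒< 2 4 _) (<-trans z<w w<y) , tt) ,
         SameOrder-< (<ᵇ⇒< 1 4 _) (<-trans x<z (<-trans z<w w<y)) , SameOrder-< (<ᵇ⇒< 1 2 _) x<z , tt) ,
        SameOrder-> (<ᵇ⇒< 1 3 _) (<-trans x<z z<w) , SameOrder-< (<ᵇ⇒< 3 4 _) w<y ,
        SameOrder-> (<ᵇ⇒< 2 3 _) z<w , tt

2413-occurrence : ∀ {p w x y z} → w ∷ x ∷ y ∷ z ∷ [] ⊆ p → x > z → z > w → w > y → contains [2413] p ≡ true
2413-occurrence {p} {w} {x} {y} {z} sub x>z z>w w>y = contains⇐ [2413] p (_ , sub , iso)
  where
  iso : OrderIso [2413] (w ∷ x ∷ y ∷ z ∷ [])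
  iso = (((tt , tt) , SameOrder-< (<ᵇ⇒< 1 3 _) (<-trans w>y z>w) , tt) ,
         SameOrder-> (<ᵇ⇒< 1 4 _) (<-trans (<-trans w>y z>w) x>z) , SameOrder-> (<ᵇ⇒< 3 4 _) x>z , tt) ,
        SameOrder-< (<ᵇ⇒< 2 4 _) (<-trans z>w x>z) , SameOrder-> (<ᵇ⇒< 1 2 _) w>y ,
        SameOrder-< (<ᵇ⇒< 2 3 _) z>w , tt

K-contains-3142-or-2413 : ∀ l {p} → p ∈ K l → 2 ≤ l → contains [3142] p ≡ true ⊎ contains [2413] p ≡ true
K-contains-3142-or-2413 l {p} p∈ 2≤l with contains [3142] p in e₁ | contains [2413] p in e₂
... | true  | _     = inj₁ refl
... | false | true  = inj₂ refl
... | false | false = ⊥-elim (Bond⇒¬noAdj l p∈S bond (proj₂ (∈K⁻ l p∈)))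
  where
  p∈S = ∈K⇒∈S l p∈
  bond : Bond p
  bond = separable⇒Bond p (<-wellFounded (length p)) (∈S⇒Unique l p∈S)
           (subst (2 ≤_) (sym (∈S⇒length l p∈S)) 2≤l)
           (λ sub x<z z<w w<y → true≢false (trans (sym (3142-occurrence sub x<z z<w w<y)) e₁))
           (λ sub x>z z>w w>y → true≢false (trans (sym (2413-occurrence sub x>z z>w w>y)) e₂))

ind : Bool → ℤ → ℤ
ind b c = if b then c else + 0

sumMap : (List ℕ → ℤ) → List (List ℕ) → ℤ
sumMap f L = sumℤ (map f L)

sumMap-filter : ∀ (P : List ℕ → Bool) f L → sumℤ (map f (filterᵇ P L)) ≡ sumMap (λ x → ind (P x) (f x)) L
sumMap-filter P f []      = refl
sumMap-filter P f (x ∷ L) with P x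
... | true  = cong (_+_ (f x)) (sumMap-filter P f L)
... | false = trans (sumMap-filter P f L) (sym (+-identityˡ _))

sumMap-cong : ∀ {f g} L → (∀ {x} → x ∈ L → f x ≡ g x) → sumMap f L ≡ sumMap g L
sumMap-cong []      _  = refl
sumMap-cong (x ∷ L) eq = cong₂ _+_ (eq (here refl)) (sumMap-cong L (eq ∘ there))

sumMap-+ : ∀ f g L → sumMap (λ x → f x + g x) L ≡ sumMap f L + sumMap g L
sumMap-+ f g []      = refl
sumMap-+ f g (x ∷ L) = trans (cong (_+_ (f x + g x)) (sumMap-+ f g L)) (interchange (f x) (g x) _ _)

sumMap-++ : ∀ f L L′ → sumMap f (L ++ L′) ≡ sumMap f L + sumMap f L′
sumMap-++ f []      L′ = sym (+-identityˡ _)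
sumMap-++ f (x ∷ L) L′ = trans (cong (_+_ (f x)) (sumMap-++ f L L′)) (sym (+-assoc (f x) _ _))

sumMap-zero : ∀ {f} L → (∀ {x} → x ∈ L → f x ≡ + 0) → sumMap f L ≡ + 0
sumMap-zero []      _   = refl
sumMap-zero (x ∷ L) is0 = cong₂ _+_ (is0 (here refl)) (sumMap-zero L (is0 ∘ there))

sumMap-single : ∀ (f : List ℕ → ℤ) L {σ} → Unique L → σ ∈ L → sumMap (λ x → ind (eqList x σ) (f x)) L ≡ f σ
sumMap-single f (x ∷ L) (x∉ ∷ _) (here refl) rewrite eqList-refl x =
  trans (cong (_+_ (f x)) (sumMap-zero L others)) (+-identityʳ (f x))
  where
  others : ∀ {y} → y ∈ L → ind (eqList y x) (f y) ≡ + 0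
  others y∈ rewrite ≢⇒eqList-false (All.lookup x∉ y∈ ∘ sym) = refl
sumMap-single f (x ∷ L) (x∉ ∷ uL) (there σ∈) rewrite ≢⇒eqList-false (All.lookup x∉ σ∈) =
  trans (+-identityˡ _) (sumMap-single f L uL σ∈)

-- The Möbius function

inInterval : List ℕ → List ℕ → List ℕ → Bool
inInterval τ σ π = contains τ π ∧ strictlyContained π σ

inInterval⇒≺ : ∀ τ σ π → inInterval τ σ π ≡ true → π ≺ σ
inInterval⇒≺ τ σ π e with _ , strict ← ∧-true⁻ (contains τ π) e
  with πσ , notEq ← ∧-true⁻ (contains π σ) strict
  = πσ , λ { refl → true≢false (trans (sym (eqList-refl π)) (trans (sym (not-involutive _)) (cong not notEq))) }

inInterval-intro : ∀ τ σ π → contains τ π ≡ true → π ≺ σ → inInterval τ σ π ≡ true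
inInterval-intro τ σ π τπ (πσ , π≢σ) rewrite τπ | πσ | ≢⇒eqList-false π≢σ = refl

sumBelow : List ℕ → List (List ℕ) → ℤ
sumBelow σ = sumMap λ π → ind (inInterval [1] σ π) (μ π)

sumUpTo : List ℕ → List (List ℕ) → ℤ
sumUpTo σ = sumMap λ π → ind (contains π σ) (μ π)

Kupto-suc : ∀ m → Kupto (suc m) ≡ Kupto m ++ K (suc m)
Kupto-suc m = begin
  concat (map K′ (applyUpTo id (suc m)))    ≡⟨ cong (concat ∘ map K′) (applyUpTo-∷ʳ id m) ⟨
  concat (map K′ (applyUpTo id m ++ m ∷ [])) ≡⟨ cong concat (map-++ K′ (applyUpTo id m) (m ∷ [])) ⟩
  concat (map K′ (applyUpTo id m) ++ K′ m ∷ []) ≡⟨ concat-++ (map K′ (applyUpTo id m)) (K′ m ∷ []) ⟨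
  Kupto m ++ K (suc m) ++ []                 ≡⟨ cong (Kupto m ++_) (++-identityʳ (K (suc m))) ⟩
  Kupto m ++ K (suc m)                       ∎
  where
  open ≡-Reasoning
  K′ = λ i → K (suc i)

-- Permutations longer than σ contribute nothing to a sum over [τ, σ).
sumMap-inInterval-Kupto : ∀ τ σ (f : List ℕ → ℤ) {l m} → length σ ≡ l → l ≤′ m →
  let F = λ π → ind (inInterval τ σ π) (f π) in sumMap F (Kupto m) ≡ sumMap F (Kupto l)
sumMap-inInterval-Kupto τ σ f len ≤′-refl = refl
sumMap-inInterval-Kupto τ σ f {l} len (≤′-step {m} l≤′m) = begin
  sumMap F (Kupto (suc m))                  ≡⟨ cong (sumMap F) (Kupto-suc m) ⟩
  sumMap F (Kupto m ++ K (suc m))           ≡⟨ sumMap-++ F (Kupto m) (K (suc m)) ⟩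
  sumMap F (Kupto m) + sumMap F (K (suc m)) ≡⟨ cong₂ _+_ (sumMap-inInterval-Kupto τ σ f len l≤′m)
                                                          (sumMap-zero (K (suc m)) tooLong) ⟩
  sumMap F (Kupto l) + + 0                  ≡⟨ +-identityʳ _ ⟩
  sumMap F (Kupto l)                        ∎
  where
  open ≡-Reasoning
  F = λ π → ind (inInterval τ σ π) (f π)
  tooLong : ∀ {π} → π ∈ K (suc m) → F π ≡ + 0
  tooLong {π} π∈ with inInterval τ σ π in e
  ... | false = refl
  ... | true  = ⊥-elim (<-irrefl refl (≤-trans (s≤s (≤′⇒≤ l≤′m))
                  (subst₂ _≤_ (∈K⇒length (suc m) π∈) len
                    (contains-length π σ (proj₁ (inInterval⇒≺ τ σ π e))))))

mobiusF-fuel : ∀ τ f g l {γ} → γ ∈ S l → l < f → l < g → mobiusF f τ γ ≡ mobiusF g τ γ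
mobiusF-fuel τ (suc f) (suc g) l {γ} γ∈ (s≤s l≤f) (s≤s l≤g) with contains τ γ
... | false = refl
... | true with eqList τ γ
... | true  = refl
... | false = cong -_ (begin
  sumℤ (map (mobiusF f τ) (filterᵇ (inInterval τ γ) L))  ≡⟨ sumMap-filter (inInterval τ γ) (mobiusF f τ) L ⟩
  sumMap (λ π → ind (inInterval τ γ π) (mobiusF f τ π)) L ≡⟨ sumMap-cong L sameTerm ⟩
  sumMap (λ π → ind (inInterval τ γ π) (mobiusF g τ π)) L ≡⟨ sumMap-filter (inInterval τ γ) (mobiusF g τ) L ⟨
  sumℤ (map (mobiusF g τ) (filterᵇ (inInterval τ γ) L))  ∎)
  where
  open ≡-Reasoning
  L = Kupto (length γ)
  sameTerm : ∀ {π} → π ∈ L → ind (inInterval τ γ π) (mobiusF f τ π) ≡ ind (inInterval τ γ π) (mobiusF g τ π)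
  sameTerm {π} π∈ with inInterval τ γ π in e
  ... | false = refl
  ... | true with l′ , _ , _ , π∈K ← ∈Kupto⁻ (length γ) π∈ =
    let l′<l = S-≺⇒< l′ l (∈K⇒∈S l′ π∈K) γ∈ (inInterval⇒≺ τ γ π e) in
    mobiusF-fuel τ f g l′ (∈K⇒∈S l′ π∈K) (<-≤-trans l′<l l≤f) (<-≤-trans l′<l l≤g)

mobiusF-suc : ∀ f τ γ → contains τ γ ≡ true → eqList τ γ ≡ false →
  mobiusF (suc f) τ γ ≡ - sumℤ (map (mobiusF f τ) (filterᵇ (inInterval τ γ) (Kupto (length γ))))
mobiusF-suc f τ γ τγ τ≢γ rewrite τγ | τ≢γ = refl

μ-unfold : ∀ l {γ} → γ ∈ S l → 2 ≤ l → μ γ ≡ - sumBelow γ (Kupto l)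
μ-unfold l {[]}     γ∈ 2≤l with refl ← ∈S⇒length l γ∈ with () ← 2≤l
μ-unfold l {_ ∷ []} γ∈ 2≤l with refl ← ∈S⇒length l γ∈ with s≤s () ← 2≤l
μ-unfold l {γ@(x ∷ y ∷ ys)} γ∈ _ = begin
  μ γ
    ≡⟨ mobiusF-suc (length γ) [1] γ (contains-[1] x (y ∷ ys)) (∧-zeroʳ (1 ≡ᵇ x)) ⟩
  - sumℤ (map (mobiusF (length γ) [1]) (filterᵇ (inInterval [1] γ) (Kupto (length γ))))
    ≡⟨ cong (λ k → - sumℤ (map (mobiusF k [1]) (filterᵇ (inInterval [1] γ) (Kupto k)))) (∈S⇒length l γ∈) ⟩
  - sumℤ (map (mobiusF l [1]) (filterᵇ (inInterval [1] γ) (Kupto l)))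
    ≡⟨ cong -_ (sumMap-filter (inInterval [1] γ) (mobiusF l [1]) (Kupto l)) ⟩
  - sumMap (λ π → ind (inInterval [1] γ π) (mobiusF l [1] π)) (Kupto l)
    ≡⟨ cong -_ (sumMap-cong (Kupto l) enoughFuel) ⟩
  - sumBelow γ (Kupto l) ∎
  where
  open ≡-Reasoning
  enoughFuel : ∀ {π} → π ∈ Kupto l →
    ind (inInterval [1] γ π) (mobiusF l [1] π) ≡ ind (inInterval [1] γ π) (μ π)
  enoughFuel {π} π∈ with inInterval [1] γ π in e
  ... | false = refl
  ... | true with l′ , _ , _ , π∈K ← ∈Kupto⁻ l π∈ with refl ← ∈K⇒length l′ π∈K =
    mobiusF-fuel [1] l (suc l′) l′ (∈K⇒∈S l′ π∈K)
      (S-≺⇒< l′ l (∈K⇒∈S l′ π∈K) γ∈ (inInterval⇒≺ [1] γ π e)) ≤-refl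

∈Kupto⇒[1]⪯ : ∀ m {γ} → γ ∈ Kupto m → contains [1] γ ≡ true
∈Kupto⇒[1]⪯ m {γ} γ∈ with l , 1≤l , _ , γ∈K ← ∈Kupto⁻ m γ∈ =
  nonempty γ (subst (1 ≤_) (sym (∈K⇒length l γ∈K)) 1≤l)
  where
  nonempty : ∀ γ → 1 ≤ length γ → contains [1] γ ≡ true
  nonempty (x ∷ xs) _ = contains-[1] x xs

ind-contains-split : ∀ γ σ c → contains [1] γ ≡ true →
  ind (contains γ σ) c ≡ ind (inInterval [1] σ γ) c + ind (eqList γ σ) c
ind-contains-split γ σ c [1]γ with eqList γ σ in e
... | true  with refl ← eqList⇒≡ γ σ e rewrite contains-refl γ | eqList-refl γ | ∧-zeroʳ (contains [1] γ) =
  sym (+-identityˡ c)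
... | false rewrite [1]γ | ∧-identityʳ (contains γ σ) = sym (+-identityʳ _)

sumUpTo≡0 : ∀ k m {σ} → σ ∈ K k → 2 ≤ k → k ≤ m → sumUpTo σ (Kupto m) ≡ + 0
sumUpTo≡0 k m {σ} σ∈ 2≤k k≤m = begin
  sumUpTo σ (Kupto m)
    ≡⟨ sumMap-cong (Kupto m) (λ {γ} γ∈ → ind-contains-split γ σ (μ γ) (∈Kupto⇒[1]⪯ m γ∈)) ⟩
  sumMap (λ γ → ind (inInterval [1] σ γ) (μ γ) + ind (eqList γ σ) (μ γ)) (Kupto m)
    ≡⟨ sumMap-+ _ _ (Kupto m) ⟩
  sumBelow σ (Kupto m) + sumMap (λ γ → ind (eqList γ σ) (μ γ)) (Kupto m)
    ≡⟨ cong₂ _+_ (sumMap-inInterval-Kupto [1] σ μ (∈K⇒length k σ∈) (≤⇒≤′ k≤m))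
                 (sumMap-single μ (Kupto m) (Unique-Kupto m) (∈Kupto⁺ m k (≤-trans (s≤s z≤n) 2≤k) k≤m σ∈)) ⟩
  sumBelow σ (Kupto k) + μ σ
    ≡⟨ cong (_+ μ σ) (trans (sym (neg-involutive _)) (cong -_ (sym (μ-unfold k (∈K⇒∈S k σ∈) 2≤k)))) ⟩
  - μ σ + μ σ
    ≡⟨ +-inverseˡ (μ σ) ⟩
  + 0 ∎
  where open ≡-Reasoning

ind-cong : ∀ {b b′} c → (b′ ≡ true → b ≡ true) → (b ≡ true → c ≡ + 0 ⊎ b′ ≡ true) → ind b c ≡ ind b′ c
ind-cong {true}  {true}  c _  _    = refl
ind-cong {false} {false} c _  _    = refl
ind-cong {false} {true}  c up _    = ⊥-elim (true≢false (sym (up refl)))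
ind-cong {true}  {false} c _  down with down refl
... | inj₁ c≡0 = c≡0
... | inj₂ ()

-- The hypotheses say that [1, δ) and [1, σ] carry the same nonzero values of μ.
μ-collapse : ∀ l k {δ σ} → δ ∈ S l → 2 ≤ l → σ ∈ K k → 2 ≤ k → k ≤ l →
  (∀ {γ} → γ ∈ Kupto l → contains γ σ ≡ true → inInterval [1] δ γ ≡ true) →
  (∀ {γ} → γ ∈ Kupto l → inInterval [1] δ γ ≡ true → μ γ ≡ + 0 ⊎ contains γ σ ≡ true) →
  μ δ ≡ + 0
μ-collapse l k {δ} {σ} δ∈ 2≤l σ∈ 2≤k k≤l up down = begin
  μ δ                    ≡⟨ μ-unfold l δ∈ 2≤l ⟩
  - sumBelow δ (Kupto l) ≡⟨ cong -_ (sumMap-cong (Kupto l) (λ γ∈ → ind-cong _ (up γ∈) (down γ∈))) ⟩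
  - sumUpTo σ (Kupto l)  ≡⟨ cong -_ (sumUpTo≡0 k l σ∈ 2≤k k≤l) ⟩
  + 0                    ∎
  where open ≡-Reasoning

[3142]∈K4 : [3142] ∈ K 4
[3142]∈K4 = there (here refl)

[2413]∈K4 : [2413] ∈ K 4
[2413]∈K4 = here refl

μ≡0-onePattern : ∀ {X Y k} → X ∈ K k → 2 ≤ k →
  (∀ l {π} → π ∈ K l → 2 ≤ l → contains X π ≡ true ⊎ contains Y π ≡ true) →
  ∀ l {δ} → δ ∈ K l → contains X δ ≡ true → contains Y δ ≡ false → δ ≢ X → μ δ ≡ + 0
μ≡0-onePattern {X} {Y} {k} X∈ 2≤k cover l = go l (<-wellFounded l)
  where
  go : ∀ l → Acc _<_ l → ∀ {δ} → δ ∈ K l → contains X δ ≡ true → contains Y δ ≡ false → δ ≢ X → μ δ ≡ + 0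
  go l (acc rec) {δ} δ∈ Xδ Y⋠δ δ≢X =
    μ-collapse l k δ∈S (≤-trans 2≤k (<⇒≤ k<l)) X∈ 2≤k (<⇒≤ k<l) up down
    where
    δ∈S = ∈K⇒∈S l δ∈
    Y⋠δ′ : contains Y δ ≢ true
    Y⋠δ′ Yδ = true≢false (trans (sym Yδ) Y⋠δ)
    k<l : k < l
    k<l = S-≺⇒< k l (∈K⇒∈S k X∈) δ∈S (Xδ , δ≢X ∘ sym)
    up : ∀ {γ} → γ ∈ Kupto l → contains γ X ≡ true → inInterval [1] δ γ ≡ true
    up {γ} γ∈ γX = inInterval-intro [1] δ γ (∈Kupto⇒[1]⪯ l γ∈)
                     (⪯-≺-trans k l (∈K⇒∈S k X∈) δ∈S γX (Xδ , δ≢X ∘ sym))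
    down : ∀ {γ} → γ ∈ Kupto l → inInterval [1] δ γ ≡ true → μ γ ≡ + 0 ⊎ contains γ X ≡ true
    down {γ} γ∈ e with ∈Kupto⁻ l γ∈
    ... | 0 , () , _
    ... | 1 , _ , _ , here refl = inj₂ (∈Kupto⇒[1]⪯ k (∈Kupto⁺ k k (≤-trans (s≤s z≤n) 2≤k) ≤-refl X∈))
    ... | l′@(suc (suc _)) , _ , _ , γ∈K
      with γδ , _ ← inInterval⇒≺ [1] δ γ e
      with cover l′ γ∈K (s≤s (s≤s z≤n))
    ... | inj₂ Yγ = ⊥-elim (Y⋠δ′ (contains-trans Y γ δ Yγ γδ))
    ... | inj₁ Xγ with ≡-dec _≟_ γ X
    ...   | yes refl = inj₂ (contains-refl X)
    ...   | no  γ≢X  = inj₁ (go l′ (rec (S-≺⇒< l′ l (∈K⇒∈S l′ γ∈K) δ∈S (inInterval⇒≺ [1] δ γ e)))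
                         γ∈K Xγ (¬-not (λ Yγ → Y⋠δ′ (contains-trans Y γ δ Yγ γδ))) γ≢X)

μ-support : ∀ l {γ} → γ ∈ K l →
  μ γ ≡ + 0 ⊎ γ ≡ [1] ⊎ γ ≡ [3142] ⊎ γ ≡ [2413] ⊎ (contains [3142] γ ≡ true × contains [2413] γ ≡ true)
μ-support 0 (here refl) = inj₁ refl
μ-support 1 (here refl) = inj₂ (inj₁ refl)
μ-support l@(suc (suc _)) {γ} γ∈ with contains [3142] γ in A | contains [2413] γ in B
... | true  | true  = inj₂ (inj₂ (inj₂ (inj₂ (refl , refl))))
... | true  | false with ≡-dec _≟_ γ [3142]
...   | yes refl = inj₂ (inj₂ (inj₁ refl))
...   | no  γ≢   = inj₁ (μ≡0-onePattern {[3142]} {[2413]} {4} [3142]∈K4 (s≤s (s≤s z≤n))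
                           K-contains-3142-or-2413 l γ∈ A B γ≢)
μ-support l@(suc (suc _)) {γ} γ∈ | false | true with ≡-dec _≟_ γ [2413]
...   | yes refl = inj₂ (inj₂ (inj₂ (inj₁ refl)))
...   | no  γ≢   = inj₁ (μ≡0-onePattern {[2413]} {[3142]} {4} [2413]∈K4 (s≤s (s≤s z≤n))
                           (λ l π∈ 2≤l → swap (K-contains-3142-or-2413 l π∈ 2≤l)) l γ∈ B A γ≢)
μ-support l@(suc (suc _)) {γ} γ∈ | false | false
  with K-contains-3142-or-2413 l γ∈ (s≤s (s≤s z≤n))
... | inj₁ A′ = ⊥-elim (true≢false (trans (sym A′) A))
... | inj₂ B′ = ⊥-elim (true≢false (trans (sym B′) B))

-- Coatoms

-- A longest element of [γ, π) lies in C(π).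
extendToC : ∀ n {π γ} → π ∈ K n → InKbelow n γ → γ ≺ π → ∃[ δ ] InC n π δ × contains γ δ ≡ true
extendToC n {π} {γ} π∈ (l , 1≤l , l<n , γ∈) γ≺π = δ , (δ∈Kbelow , δ≺π , nothingBetween) , γδ
  where
  cands = filterᵇ (inInterval γ π) (Kupto n)
  ∈cands⁺ : ∀ {ε} → ε ∈ Kupto n → inInterval γ π ε ≡ true → ε ∈ cands
  ∈cands⁺ ε∈ e = ∈-filter⁺ (T? ∘ inInterval γ π) ε∈ (≡true⇒T e)
  δ = argmax length γ cands
  δ∈cands : δ ∈ cands
  δ∈cands = argmax-all length
              (∈cands⁺ (∈Kupto⁺ n l 1≤l (<⇒≤ l<n) γ∈) (inInterval-intro γ π γ (contains-refl γ) γ≺π))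
              (All.tabulate id)
  δ∈Kupto = proj₁ (∈-filter⁻ (T? ∘ inInterval γ π) {xs = Kupto n} δ∈cands)
  δ∈interval = T⇒≡true (proj₂ (∈-filter⁻ (T? ∘ inInterval γ π) {xs = Kupto n} δ∈cands))
  γδ = proj₁ (∧-true⁻ (contains γ δ) δ∈interval)
  δ≺π = inInterval⇒≺ γ π δ δ∈interval
  δ∈Kbelow : InKbelow n δ
  δ∈Kbelow with l′ , 1≤l′ , _ , δ∈K ← ∈Kupto⁻ n δ∈Kupto =
    l′ , 1≤l′ , S-≺⇒< l′ n (∈K⇒∈S l′ δ∈K) (∈K⇒∈S n π∈) δ≺π , δ∈K
  nothingBetween : ¬ (Σ (List ℕ) λ ε → InKbelow n ε × (δ ≺ ε) × (ε ≺ π))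
  nothingBetween (ε , (l′ , 1≤l′ , l′<n , ε∈) , δ≺ε , ε≺π) =
    <⇒≱ longer (All.lookup (f[xs]≤f[argmax] γ cands) ε∈cands)
    where
    ε∈cands = ∈cands⁺ (∈Kupto⁺ n l′ 1≤l′ (<⇒≤ l′<n) ε∈)
                (inInterval-intro γ π ε (contains-trans γ δ ε γδ (proj₁ δ≺ε)) ε≺π)
    longer : length δ < length ε
    longer with l″ , _ , _ , δ∈K ← ∈Kupto⁻ n δ∈Kupto =
      subst₂ _<_ (sym (∈K⇒length l″ δ∈K)) (sym (∈K⇒length l′ ε∈))
        (S-≺⇒< l″ l′ (∈K⇒∈S l″ δ∈K) (∈K⇒∈S l′ ε∈) δ≺ε)

Good-upward : ∀ {γ δ} → contains [3142] γ ≡ true → contains [2413] γ ≡ true → contains γ δ ≡ true → Good δ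
Good-upward {γ} {δ} Aγ Bγ γδ =
  (Aδ , λ { refl → true≢false (sym Bδ) }) , (Bδ , λ { refl → true≢false (sym Aδ) })
  where
  Aδ = contains-trans [3142] γ δ Aγ γδ
  Bδ = contains-trans [2413] γ δ Bγ γδ

-- γ lies under some δ ∈ C(π), which is good and hence equal to σ.
uniqueGood⇒below : ∀ n {π σ} → π ∈ K n → ((σ′ : List ℕ) → InC n π σ′ → Good σ′ → σ′ ≡ σ) →
  ∀ l {γ} → γ ∈ K l → 1 ≤ l → contains [3142] γ ≡ true → contains [2413] γ ≡ true →
  γ ≺ π → contains γ σ ≡ true
uniqueGood⇒below n π∈ unique l {γ} γ∈ 1≤l Aγ Bγ γ≺π
  with δ , δ∈C , γδ ← extendToC n π∈ (l , 1≤l , S-≺⇒< l n (∈K⇒∈S l γ∈) (∈K⇒∈S n π∈) γ≺π , γ∈) γ≺π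
  with refl ← unique δ δ∈C (Good-upward {γ} Aγ Bγ γδ)
  = γδ

mainTheorem13 : (n : ℕ) (π : List ℕ) → π ∈ K n →
    Σ (List ℕ) (λ σ → (InC n π σ × Good σ) ×
      ((σ' : List ℕ) → InC n π σ' → Good σ' → σ' ≡ σ)) →
    μ π ≡ + 0
mainTheorem13 n π π∈ (σ , ((((ls , 1≤ls , ls<n , σ∈) , σ≺π , _) , good) , unique)) =
  μ-collapse n ls (∈K⇒∈S n π∈) (≤-trans 2≤ls (<⇒≤ ls<n)) σ∈ 2≤ls (<⇒≤ ls<n) up down
  where
  2≤ls : 2 ≤ ls
  2≤ls = ≤-trans (s≤s (s≤s z≤n)) (<⇒≤ (S-≺⇒< 4 ls (∈K⇒∈S 4 [3142]∈K4) (∈K⇒∈S ls σ∈) (proj₁ good)))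
  up : ∀ {γ} → γ ∈ Kupto n → contains γ σ ≡ true → inInterval [1] π γ ≡ true
  up {γ} γ∈ γσ =
    inInterval-intro [1] π γ (∈Kupto⇒[1]⪯ n γ∈) (⪯-≺-trans ls n (∈K⇒∈S ls σ∈) (∈K⇒∈S n π∈) γσ σ≺π)
  down : ∀ {γ} → γ ∈ Kupto n → inInterval [1] π γ ≡ true → μ γ ≡ + 0 ⊎ contains γ σ ≡ true
  down {γ} γ∈ e with l , 1≤l , _ , γ∈K ← ∈Kupto⁻ n γ∈ with μ-support l γ∈K
  ... | inj₁ μγ≡0                      = inj₁ μγ≡0
  ... | inj₂ (inj₁ refl)               = inj₂ (∈Kupto⇒[1]⪯ ls (∈Kupto⁺ ls ls 1≤ls ≤-refl σ∈))
  ... | inj₂ (inj₂ (inj₁ refl))        = inj₂ (proj₁ (proj₁ good))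
  ... | inj₂ (inj₂ (inj₂ (inj₁ refl))) = inj₂ (proj₁ (proj₂ good))
  ... | inj₂ (inj₂ (inj₂ (inj₂ (Aγ , Bγ)))) =
    inj₂ (uniqueGood⇒below n π∈ unique l γ∈K 1≤l Aγ Bγ (inInterval⇒≺ [1] π γ e))
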